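{- For every integer $N \ge 2$, $a(N) = r(N) = f(N) + 1$.
   Context: Setting (alternator coin problem): There are $N$ identical-looking coins. All but one are real and have the same weight. The remaining coin, the alternator, behaves as follows: each time it is placed on a balance scale it weighs either the same as a real coin ("acts real") or strictly less than a real coin ("acts fake"), and it switches between these two behaviours every time it is on the scale; while off the scale its behaviour does not change. A weighing places two disjoint sets of coins with the same number of coins on the two pans, and its outcome is one of: the pans balance, the left pan is lighter, or the right pan is lighter. Weighings may be chosen adaptively. A strategy finds the alternator if, for every possible identity of the alternator, the outcomes determine which coin it is. The alternator is in the $f$-state if the next time it is on the scale it will act fake, and in the $r$-state if the next time it is on the scale it will act real. $f(N)$ (resp. $r(N)$) is the smallest number of weighings guaranteeing to find the alternator among $N$ coins when it starts in the $f$-state (resp. $r$-state), and $a(N)$ is the same quantity when the starting state is unknown (may be either). -}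

module Defs where

open import Data.Nat using (ℕ; zero; suc; _+_; _<_)
open import Data.Fin using (Fin; zero; suc)
open import Data.Product using (Σ; _×_)
open import Relation.Binary.PropositionalEquality using (_≡_)
open import Relation.Nullary using (¬_)
open import Data.Unit using (⊤)

data Pan : Set where
  left right off : Pan

data Outcome : Set where
  balance leftLighter rightLighter : Outcome

-- State of the alternator: f-state (next time on the scale it acts fake)
-- or r-state (next time on the scale it acts real).
data AltState : Set where
  fState rState : AltState

flipState : AltState → AltState
flipState fState = rState
flipState rState = fState

isPan : Pan → Pan → ℕ
isPan left  left  = 1
isPan right right = 1
isPan off   off   = 1
isPan _     _     = 0

count : {N : ℕ} → (Fin N → Pan) → Pan → ℕ
count {zero}  w p = 0
count {suc n} w p = isPan (w zero) p + count (λ i → w (suc i)) p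

record Weighing (N : ℕ) : Set where
  constructor mkWeighing
  field
    pans     : Fin N → Pan
    balanced : count pans left ≡ count pans right
open Weighing public

outcome : Pan → AltState → Outcome
outcome left  fState = leftLighter
outcome right fState = rightLighter
outcome _     _      = balance

nextState : Pan → AltState → AltState
nextState off s = s
nextState _   s = flipState s

-- Adaptive strategies using at most k weighings: decision trees of height ≤ k
-- whose leaves announce a coin.
data Strategy (N : ℕ) : ℕ → Set where
  answer : {k : ℕ} → Fin N → Strategy N k
  weigh  : {k : ℕ} → Weighing N → (Outcome → Strategy N k) → Strategy N (suc k)

run : {N k : ℕ} → Strategy N k → Fin N → AltState → Fin N
run (answer d)  c s = d
run (weigh w t) c s =
  run (t (outcome (pans w c) s)) c (nextState (pans w c) s)

Finds : {N k : ℕ} → (AltState → Set) → Strategy N k → Set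
Finds {N} S t = (c : Fin N) (s : AltState) → S s → run t c s ≡ c

Solvable : (N : ℕ) → (AltState → Set) → ℕ → Set
Solvable N S k = Σ (Strategy N k) (Finds S)

startF : AltState → Set
startF s = s ≡ fState

startR : AltState → Set
startR s = s ≡ rState

startAny : AltState → Set
startAny s = ⊤

IsMinWeighings : (ℕ → Set) → ℕ → Set
IsMinWeighings P m = P m × ((k : ℕ) → k < m → ¬ P k)

-- Write F_k, R_k for maxCoins k fState, maxCoins k rState: F_0 = R_0 = 1, F_(k+1) = F_k + 2 R_k and
-- R_(k+1) = F_k. These are exactly the numbers of coins that k weighings can handle from the f-state and
-- from the r-state, and R_(k+1) = F_k gives r(N) = f(N) + 1.
--
-- Lower bound: a weighing cuts [0, F_(k+1)) into slots of widths F_k (balance), R_k and R_k (a lighter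
-- pan), while an r-state alternator always balances, leaving the single slot [0, F_k). Nesting the slots
-- along a run gives each coin a code below maxCoins k s that determines the answer of the strategy, so a
-- strategy that always succeeds injects the N coins into maxCoins k s codes.
--
-- Upper bound: from the f-state put min (R_k, ⌊n/2⌋) suspects on each pan; a lighter pan leaves an r-state
-- alternator among at most R_k coins, a balance an f-state one among the at most F_k coins off the scale.
-- From the r-state weigh ⌊n/2⌋ against ⌊n/2⌋: the scale balances and afterwards every suspect is in the
-- f-state except possibly the one coin left off. The same first weighing serves an unknown starting state,
-- because ⌊F_k/2⌋ ≤ R_k; the one coin of unknown state is harmless since it is the lowest suspect, which the
-- f-state strategy always keeps in its balance branch, and an r-state alternator always balances.

module Submission where

open import Defs
open import Data.Nat using (ℕ; zero; suc; _+_; _*_; _∸_; _≤_; _<_; _⊓_; z≤n; s≤s; s≤s⁻¹; _≤?_; ⌊_/2⌋)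
open import Data.Nat.Properties
open import Data.Fin using (Fin; zero; suc; toℕ; fromℕ<)
open import Data.Fin.Properties using (toℕ<n; toℕ-fromℕ<; injective⇒≤)
open import Data.Product using (Σ; _×_; _,_)
open import Data.Sum using (_⊎_; inj₁; inj₂)
open import Data.Unit using (tt)
open import Relation.Binary.PropositionalEquality
open import Relation.Nullary using (yes; no; contradiction)

maxCoins : ℕ → AltState → ℕ
maxCoins zero    _      = 1
maxCoins (suc k) fState = maxCoins k fState + (maxCoins k rState + maxCoins k rState)
maxCoins (suc k) rState = maxCoins k fState

maxCoins-pos : ∀ k s → 0 < maxCoins k s
maxCoins-pos zero    s      = s≤s z≤n
maxCoins-pos (suc k) fState = ≤-trans (maxCoins-pos k fState) (m≤m+n _ _)
maxCoins-pos (suc k) rState = maxCoins-pos k fState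

maxCoins-r≤f : ∀ k → maxCoins k rState ≤ maxCoins k fState
maxCoins-r≤f zero    = ≤-refl
maxCoins-r≤f (suc k) = m≤m+n _ _

maxCoins-f-< : ∀ k → maxCoins k fState < maxCoins (suc k) fState
maxCoins-f-< k = m<m+n _ (≤-trans (maxCoins-pos k rState) (m≤m+n _ _))

mutual
  maxCoins-f≤1+2r : ∀ k → maxCoins k fState ≤ suc (maxCoins k rState + maxCoins k rState)
  maxCoins-f≤1+2r zero    = s≤s z≤n
  maxCoins-f≤1+2r (suc k) = begin
      F + (R + R)  ≤⟨ +-monoʳ-≤ F (maxCoins-2r≤1+f k) ⟩
      F + suc F    ≡⟨ +-suc F F ⟩
      suc (F + F)  ∎
    where
    open ≤-Reasoning
    F R : ℕ
    F = maxCoins k fState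
    R = maxCoins k rState

  maxCoins-2r≤1+f : ∀ k → maxCoins k rState + maxCoins k rState ≤ suc (maxCoins k fState)
  maxCoins-2r≤1+f zero    = ≤-refl
  maxCoins-2r≤1+f (suc k) = begin
      F + F            ≤⟨ +-monoʳ-≤ F (maxCoins-f≤1+2r k) ⟩
      F + suc (R + R)  ≡⟨ +-suc F (R + R) ⟩
      suc (F + (R + R)) ∎
    where
    open ≤-Reasoning
    F R : ℕ
    F = maxCoins k fState
    R = maxCoins k rState

⌊maxCoins-f/2⌋≤maxCoins-r : ∀ k → ⌊ maxCoins k fState /2⌋ ≤ maxCoins k rState
⌊maxCoins-f/2⌋≤maxCoins-r k =
  ≤-trans (⌊n/2⌋-mono (maxCoins-f≤1+2r k)) (≤-reflexive (sym (n≡⌈n+n/2⌉ (maxCoins k rState))))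

offset : ℕ → Outcome → ℕ
offset k balance      = 0
offset k leftLighter  = maxCoins k fState
offset k rightLighter = maxCoins k fState + maxCoins k rState

width : ℕ → Outcome → ℕ
width k balance      = maxCoins k fState
width k leftLighter  = maxCoins k rState
width k rightLighter = maxCoins k rState

slots-fit : ∀ k p s → offset k (outcome p s) + width k (outcome p s) ≤ maxCoins (suc k) s
slots-fit k left  fState = +-monoʳ-≤ (maxCoins k fState) (m≤m+n _ _)
slots-fit k right fState = ≤-reflexive (+-assoc (maxCoins k fState) _ _)
slots-fit k off   fState = m≤m+n _ _
slots-fit k left  rState = ≤-refl
slots-fit k right rState = ≤-refl
slots-fit k off   rState = ≤-refl

maxCoins-next≤width : ∀ k p s → maxCoins k (nextState p s) ≤ width k (outcome p s)
maxCoins-next≤width k left  fState = ≤-refl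
maxCoins-next≤width k right fState = ≤-refl
maxCoins-next≤width k off   fState = ≤-refl
maxCoins-next≤width k left  rState = ≤-refl
maxCoins-next≤width k right rState = ≤-refl
maxCoins-next≤width k off   rState = maxCoins-r≤f k

slots-disjoint : ∀ {a b w x y} → x < w → a + w ≤ b → a + x ≢ b + y
slots-disjoint {a} {b} {w} {x} {y} x<w a+w≤b a+x≡b+y = <⇒≱ (+-monoʳ-< a x<w) (begin
  a + w  ≤⟨ a+w≤b ⟩
  b      ≤⟨ m≤m+n b y ⟩
  b + y  ≡⟨ sym a+x≡b+y ⟩
  a + x  ∎)
  where open ≤-Reasoning

slot-injective : ∀ k {o o′ x x′} → x < width k o → x′ < width k o′ →
                 offset k o + x ≡ offset k o′ + x′ → o ≡ o′ × x ≡ x′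
slot-injective k {balance}      {balance}      _  _  e = refl , e
slot-injective k {leftLighter}  {leftLighter}  _  _  e = refl , +-cancelˡ-≡ _ _ _ e
slot-injective k {rightLighter} {rightLighter} _  _  e = refl , +-cancelˡ-≡ _ _ _ e
slot-injective k {balance}      {leftLighter}  x< _  e = contradiction e (slots-disjoint x< ≤-refl)
slot-injective k {leftLighter}  {balance}      _  x< e = contradiction (sym e) (slots-disjoint x< ≤-refl)
slot-injective k {balance}      {rightLighter} x< _  e = contradiction e (slots-disjoint x< (m≤m+n _ _))
slot-injective k {rightLighter} {balance}      _  x< e = contradiction (sym e) (slots-disjoint x< (m≤m+n _ _))
slot-injective k {leftLighter}  {rightLighter} x< _  e = contradiction e (slots-disjoint x< ≤-refl)
slot-injective k {rightLighter} {leftLighter}  _  x< e = contradiction (sym e) (slots-disjoint x< ≤-refl)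

code : {N k : ℕ} → Strategy N k → Fin N → AltState → ℕ
code (answer _)      c s = 0
code (weigh {k} w t) c s =
  offset k (outcome (pans w c) s) + code (t (outcome (pans w c) s)) c (nextState (pans w c) s)

mutual
  code<maxCoins : {N k : ℕ} (t : Strategy N k) (c : Fin N) (s : AltState) → code t c s < maxCoins k s
  code<maxCoins {k = k} (answer _) c s = maxCoins-pos k s
  code<maxCoins (weigh {k} w t) c s =
    <-≤-trans (+-monoʳ-< (offset k (outcome (pans w c) s)) (subcode<width w t c s)) (slots-fit k (pans w c) s)

  subcode<width : {N k : ℕ} (w : Weighing N) (t : Outcome → Strategy N k) (c : Fin N) (s : AltState) →
                  code (t (outcome (pans w c) s)) c (nextState (pans w c) s) < width k (outcome (pans w c) s)
  subcode<width {k = k} w t c s =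
    <-≤-trans (code<maxCoins (t (outcome (pans w c) s)) c (nextState (pans w c) s))
              (maxCoins-next≤width k (pans w c) s)

code-determines-run : {N k : ℕ} (t : Strategy N k) (c c′ : Fin N) (s s′ : AltState) →
                      code t c s ≡ code t c′ s′ → run t c s ≡ run t c′ s′
code-determines-run (answer _)      c c′ s s′ _ = refl
code-determines-run (weigh {k} w t) c c′ s s′ e
  with slot-injective k (subcode<width w t c s) (subcode<width w t c′ s′) e
... | o≡o′ , x≡x′ = subtree o≡o′ x≡x′
  where
  q q′ : AltState
  q  = nextState (pans w c) s
  q′ = nextState (pans w c′) s′

  subtree : ∀ {o o′} → o ≡ o′ → code (t o) c q ≡ code (t o′) c′ q′ → run (t o) c q ≡ run (t o′) c′ q′
  subtree refl = code-determines-run (t _) c c′ q q′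

finds⇒≤maxCoins : {N k : ℕ} (t : Strategy N k) (s : AltState) → (∀ c → run t c s ≡ c) → N ≤ maxCoins k s
finds⇒≤maxCoins {N} {k} t s finds = injective⇒≤ codeFin-injective
  where
  codeFin : Fin N → Fin (maxCoins k s)
  codeFin c = fromℕ< (code<maxCoins t c s)

  codeFin-injective : ∀ {c c′} → codeFin c ≡ codeFin c′ → c ≡ c′
  codeFin-injective {c} {c′} e = begin
    c           ≡⟨ sym (finds c) ⟩
    run t c s   ≡⟨ code-determines-run t c c′ s s (begin
                     code t c s            ≡⟨ sym (toℕ-fromℕ< (code<maxCoins t c s)) ⟩
                     toℕ (codeFin c)      ≡⟨ cong toℕ e ⟩
                     toℕ (codeFin c′)     ≡⟨ toℕ-fromℕ< (code<maxCoins t c′ s) ⟩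
                     code t c′ s          ∎) ⟩
    run t c′ s  ≡⟨ finds c′ ⟩
    c′          ∎
    where open ≡-Reasoning

paint : Pan → ℕ → (ℕ → Pan) → ℕ → Pan
paint p zero    g i       = g i
paint p (suc k) g zero    = p
paint p (suc k) g (suc i) = paint p k g i

paint-split : ∀ p k g i → (i < k × paint p k g i ≡ p) ⊎ Σ ℕ (λ j → i ≡ k + j × paint p k g i ≡ g j)
paint-split p zero    g i       = inj₂ (i , refl , refl)
paint-split p (suc k) g zero    = inj₁ (s≤s z≤n , refl)
paint-split p (suc k) g (suc i) with paint-split p k g i
... | inj₁ (i<k , e)        = inj₁ (s≤s i<k , e)
... | inj₂ (j , refl , e)   = inj₂ (j , refl , e)

countUpTo : (ℕ → Pan) → ℕ → Pan → ℕ
countUpTo g zero    q = 0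
countUpTo g (suc n) q = isPan (g 0) q + countUpTo (λ i → g (suc i)) n q

count-toℕ : (g : ℕ → Pan) (n : ℕ) (q : Pan) → count {n} (λ c → g (toℕ c)) q ≡ countUpTo g n q
count-toℕ g zero    q = refl
count-toℕ g (suc n) q = cong (isPan (g 0) q +_) (count-toℕ (λ i → g (suc i)) n q)

countUpTo-const : ∀ p n q → countUpTo (λ _ → p) n q ≡ isPan p q * n
countUpTo-const p zero    q = sym (*-zeroʳ (isPan p q))
countUpTo-const p (suc n) q = trans (cong (isPan p q +_) (countUpTo-const p n q)) (sym (*-suc (isPan p q) n))

countUpTo-paint : ∀ p k g n q → countUpTo (paint p k g) (k + n) q ≡ isPan p q * k + countUpTo g n q
countUpTo-paint p zero    g n q = cong (_+ countUpTo g n q) (sym (*-zeroʳ (isPan p q)))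
countUpTo-paint p (suc k) g n q = begin
    isPan p q + countUpTo (paint p k g) (k + n) q
  ≡⟨ cong (isPan p q +_) (countUpTo-paint p k g n q) ⟩
    isPan p q + (isPan p q * k + countUpTo g n q)
  ≡⟨ sym (+-assoc (isPan p q) _ _) ⟩
    isPan p q + isPan p q * k + countUpTo g n q
  ≡⟨ cong (_+ countUpTo g n q) (sym (*-suc (isPan p q) k)) ⟩
    isPan p q * suc k + countUpTo g n q ∎
  where open ≡-Reasoning

pairLayout : ℕ → ℕ → ℕ → Pan
pairLayout a m = paint off a (paint left m (paint right m (λ _ → off)))

countUpTo-pairLayout : ∀ a m r q → countUpTo (pairLayout a m) (a + (m + (m + r))) q
                       ≡ isPan off q * a + (isPan left q * m + (isPan right q * m + isPan off q * r))
countUpTo-pairLayout a m r q = begin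
    countUpTo (pairLayout a m) (a + (m + (m + r))) q
  ≡⟨ countUpTo-paint off a _ _ q ⟩
    isPan off q * a + countUpTo (paint left m _) (m + (m + r)) q
  ≡⟨ cong (isPan off q * a +_) (countUpTo-paint left m _ _ q) ⟩
    isPan off q * a + (isPan left q * m + countUpTo (paint right m _) (m + r) q)
  ≡⟨ cong (λ x → isPan off q * a + (isPan left q * m + x)) (countUpTo-paint right m _ r q) ⟩
    isPan off q * a + (isPan left q * m + (isPan right q * m + countUpTo (λ _ → off) r q))
  ≡⟨ cong (λ x → isPan off q * a + (isPan left q * m + (isPan right q * m + x))) (countUpTo-const off r q) ⟩
    isPan off q * a + (isPan left q * m + (isPan right q * m + isPan off q * r)) ∎
  where open ≡-Reasoning

idle-balanced : ∀ N → count {N} (λ _ → off) left ≡ count {N} (λ _ → off) right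
idle-balanced zero    = refl
idle-balanced (suc N) = idle-balanced N

pairLayout-balanced : ∀ {N} a m → a + m + m ≤ N →
                      count {N} (λ c → pairLayout a m (toℕ c)) left
                      ≡ count {N} (λ c → pairLayout a m (toℕ c)) right
pairLayout-balanced {N} a m fits = trans (count-q left) (sym (count-q right))
  where
  r : ℕ
  r = N ∸ (a + m + m)

  N≡ : N ≡ a + (m + (m + r))
  N≡ = trans (sym (m+[n∸m]≡n fits)) (trans (+-assoc (a + m) m r) (+-assoc a m (m + r)))

  count-q : ∀ q → count {N} (λ c → pairLayout a m (toℕ c)) q
                  ≡ isPan off q * a + (isPan left q * m + (isPan right q * m + isPan off q * r))
  count-q q = trans (count-toℕ (pairLayout a m) N q)
                (trans (cong (λ n → countUpTo (pairLayout a m) n q) N≡) (countUpTo-pairLayout a m r q))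

-- The layout only balances when it fits among the N coins; otherwise nothing is weighed
-- (the strategies below only use layouts that fit).
pairWeighing : {N : ℕ} → ℕ → ℕ → Weighing N
pairWeighing {N} a m with a + m + m ≤? N
... | yes fits = mkWeighing (λ c → pairLayout a m (toℕ c)) (pairLayout-balanced a m fits)
... | no _     = mkWeighing (λ _ → off) (idle-balanced N)

pans-pairWeighing : ∀ {N a m} → a + m + m ≤ N → (c : Fin N) → pans (pairWeighing a m) c ≡ pairLayout a m (toℕ c)
pans-pairWeighing {N} {a} {m} fits c with a + m + m ≤? N
... | yes _     = refl
... | no ¬fits  = contradiction fits ¬fits

run-weigh : ∀ {N k} (w : Weighing N) (t : Outcome → Strategy N k) {c s p} →
            pans w c ≡ p → run (weigh w t) c s ≡ run (t (outcome p s)) c (nextState p s)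
run-weigh w t {c} {s} e = cong (λ p → run (t (outcome p s)) c (nextState p s)) e

data PairPosition (a m i : ℕ) : Set where
  offBefore : pairLayout a m i ≡ off   → i < a → PairPosition a m i
  onLeft    : pairLayout a m i ≡ left  → a ≤ i → i < a + m → PairPosition a m i
  onRight   : pairLayout a m i ≡ right → a + m ≤ i → i < a + m + m → PairPosition a m i
  offAfter  : pairLayout a m i ≡ off   → a + m + m ≤ i → PairPosition a m i

pairPosition : ∀ a m i → PairPosition a m i
pairPosition a m i with paint-split off a (paint left m (paint right m (λ _ → off))) i
... | inj₁ (i<a , e)       = offBefore e i<a
... | inj₂ (j , refl , e) with paint-split left m (paint right m (λ _ → off)) j
...   | inj₁ (j<m , e′)       = onLeft (trans e e′) (m≤m+n a j) (+-monoʳ-< a j<m)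
...   | inj₂ (j′ , refl , e′) with paint-split right m (λ _ → off) j′
...     | inj₁ (j′<m , e′′)     = onRight (trans e (trans e′ e′′))
                                    (subst (a + m ≤_) (+-assoc a m j′) (m≤m+n (a + m) j′))
                                    (subst (_< a + m + m) (+-assoc a m j′) (+-monoʳ-< (a + m) j′<m))
...     | inj₂ (j′′ , refl , e′′) = offAfter (trans e (trans e′ e′′))
                                    (subst (a + m + m ≤_)
                                      (trans (+-assoc (a + m) m j′′) (+-assoc a m (m + j′′)))
                                      (m≤m+n (a + m + m) j′′))

clamp : (M : ℕ) → ℕ → Fin (suc M)
clamp M       zero    = zero
clamp zero    (suc i) = zero
clamp (suc M) (suc i) = suc (clamp M i)

clamp-toℕ : ∀ {M} (c : Fin (suc M)) → clamp M (toℕ c) ≡ c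
clamp-toℕ         zero    = refl
clamp-toℕ {suc M} (suc c) = cong suc (clamp-toℕ c)

short-interval-≡ : ∀ {lo i n} → lo ≤ i → i < lo + n → n ≤ 1 → i ≡ lo
short-interval-≡ {lo} {i} {n} lo≤i i<lo+n n≤1 =
  ≤-antisym (s≤s⁻¹ (≤-trans i<lo+n (subst (lo + n ≤_) (+-comm lo 1) (+-monoʳ-≤ lo n≤1)))) lo≤i

⌊n/2⌋+⌊n/2⌋≤n : ∀ n → ⌊ n /2⌋ + ⌊ n /2⌋ ≤ n
⌊n/2⌋+⌊n/2⌋≤n n = ≤-trans (+-monoʳ-≤ ⌊ n /2⌋ (⌊n/2⌋≤⌈n/2⌉ n)) (≤-reflexive (⌊n/2⌋+⌈n/2⌉≡n n))

n≤1+⌊n/2⌋+⌊n/2⌋ : ∀ n → n ≤ suc (⌊ n /2⌋ + ⌊ n /2⌋)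
n≤1+⌊n/2⌋+⌊n/2⌋ n = begin
  n                           ≡⟨ sym (⌊n/2⌋+⌈n/2⌉≡n n) ⟩
  ⌊ n /2⌋ + ⌊ suc n /2⌋       ≤⟨ +-monoʳ-≤ ⌊ n /2⌋ (⌊n/2⌋-mono (n≤1+n (suc n))) ⟩
  ⌊ n /2⌋ + suc ⌊ n /2⌋       ≡⟨ +-suc ⌊ n /2⌋ ⌊ n /2⌋ ⟩
  suc (⌊ n /2⌋ + ⌊ n /2⌋)     ∎
  where open ≤-Reasoning

unweighed : ℕ → ℕ → ℕ
unweighed n m = n ∸ (m + m)

unweighed-+-pans : ∀ lo {n m} → m + m ≤ n → lo + unweighed n m + m + m ≡ lo + n
unweighed-+-pans lo {n} {m} 2m≤n = begin
  lo + unweighed n m + m + m    ≡⟨ +-assoc (lo + unweighed n m) m m ⟩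
  lo + unweighed n m + (m + m)  ≡⟨ +-assoc lo (unweighed n m) (m + m) ⟩
  lo + (unweighed n m + (m + m)) ≡⟨ cong (lo +_) (m∸n+n≡m 2m≤n) ⟩
  lo + n                        ∎
  where open ≡-Reasoning

pairs-fit : ∀ {N} lo {n m} → m + m ≤ n → lo + n ≤ N → lo + unweighed n m + m + m ≤ N
pairs-fit {N} lo 2m≤n = subst (_≤ N) (sym (unweighed-+-pans lo 2m≤n))

unweighed-half≤1 : ∀ n → unweighed n ⌊ n /2⌋ ≤ 1
unweighed-half≤1 n =
  m≤n+o⇒m∸n≤o n (⌊ n /2⌋ + ⌊ n /2⌋) (subst (n ≤_) (+-comm 1 _) (n≤1+⌊n/2⌋+⌊n/2⌋ n))

panSize : ℕ → ℕ → ℕ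
panSize k n = maxCoins k rState ⊓ ⌊ n /2⌋

panSize+panSize≤n : ∀ k n → panSize k n + panSize k n ≤ n
panSize+panSize≤n k n = ≤-trans (+-mono-≤ h≤ h≤) (⌊n/2⌋+⌊n/2⌋≤n n)
  where
  h≤ : panSize k n ≤ ⌊ n /2⌋
  h≤ = m⊓n≤n (maxCoins k rState) ⌊ n /2⌋

unweighed-panSize≤maxCoins : ∀ k n → n ≤ maxCoins (suc k) fState → unweighed n (panSize k n) ≤ maxCoins k fState
unweighed-panSize≤maxCoins k n n≤F with ≤-total (maxCoins k rState) ⌊ n /2⌋
... | inj₁ R≤h rewrite m≤n⇒m⊓n≡m R≤h = m≤n+o⇒m∸n≤o n _ (subst (n ≤_) (+-comm (maxCoins k fState) _) n≤F)
... | inj₂ h≤R rewrite m≥n⇒m⊓n≡n h≤R = ≤-trans (unweighed-half≤1 n) (maxCoins-pos k fState)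

module Strategies (M : ℕ) where

  N : ℕ
  N = suc M

  mutual
    findF : ℕ → ℕ → (k : ℕ) → Strategy N k
    findF lo n zero    = answer (clamp M lo)
    findF lo n (suc k) = weighPairs (lo + unweighed n (panSize k n)) (panSize k n) k
                                    (findF lo (unweighed n (panSize k n)) k)

    findR : ℕ → ℕ → (k : ℕ) → Strategy N k
    findR lo n zero    = answer (clamp M lo)
    findR lo n (suc k) = weighPairs (lo + unweighed n ⌊ n /2⌋) ⌊ n /2⌋ k (findF lo n k)

    weighPairs : ℕ → ℕ → (k : ℕ) → Strategy N k → Strategy N (suc k)
    weighPairs a m k onBalance = weigh (pairWeighing a m) (afterPairs a m k onBalance)

    afterPairs : ℕ → ℕ → (k : ℕ) → Strategy N k → Outcome → Strategy N k
    afterPairs a m k onBalance balance      = onBalance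
    afterPairs a m k onBalance leftLighter  = findR a m k
    afterPairs a m k onBalance rightLighter = findR (a + m) m k

  -- The suspects of findF lo n: the coins of [lo, lo + n) in the f-state, and coin lo in either state.
  Located : ℕ → ℕ → Fin N → AltState → Set
  Located lo n c s = (lo ≤ toℕ c × toℕ c < lo + n × s ≡ fState) ⊎ toℕ c ≡ lo

  run-weighPairs : ∀ a m {k s p} {c : Fin N} (t : Strategy N k) → a + m + m ≤ N → pairLayout a m (toℕ c) ≡ p →
                   run (weighPairs a m k t) c s ≡ run (afterPairs a m k t (outcome p s)) c (nextState p s)
  run-weighPairs a m {k} {c = c} t fits e =
    run-weigh (pairWeighing a m) (afterPairs a m k t) (trans (pans-pairWeighing {a = a} {m} fits c) e)

  answer-ok : ∀ {lo} {c : Fin N} → toℕ c ≡ lo → clamp M lo ≡ c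
  answer-ok refl = clamp-toℕ _

  weighPairs-rState : ∀ {a m k} {c : Fin N} (t : Strategy N k) → a + m + m ≤ N →
                      run t c fState ≡ c → (toℕ c < a ⊎ a + m + m ≤ toℕ c → run t c rState ≡ c) →
                      run (weighPairs a m k t) c rState ≡ c
  weighPairs-rState {a} {m} {c = c} t fits onScale offScale with pairPosition a m (toℕ c)
  ... | offBefore e i<a   = trans (run-weighPairs a m t fits e) (offScale (inj₁ i<a))
  ... | offAfter e i≥     = trans (run-weighPairs a m t fits e) (offScale (inj₂ i≥))
  ... | onLeft e _ _      = trans (run-weighPairs a m t fits e) onScale
  ... | onRight e _ _     = trans (run-weighPairs a m t fits e) onScale

  mutual
    weighPairs-fState : ∀ {a m k} {c : Fin N} (t : Strategy N k) → a + m + m ≤ N → m ≤ maxCoins k rState →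
                        (toℕ c < a ⊎ a + m + m ≤ toℕ c → run t c fState ≡ c) →
                        run (weighPairs a m k t) c fState ≡ c
    weighPairs-fState {a} {m} {k} {c} t fits m≤R offScale with pairPosition a m (toℕ c)
    ... | offBefore e i<a = trans (run-weighPairs a m t fits e) (offScale (inj₁ i<a))
    ... | offAfter e i≥   = trans (run-weighPairs a m t fits e) (offScale (inj₂ i≥))
    ... | onLeft e x y    = trans (run-weighPairs a m t fits e)
                                  (findR-ok a m k (≤-trans (m≤m+n (a + m) m) fits) m≤R x y)
    ... | onRight e x y   = trans (run-weighPairs a m t fits e)
                                  (findR-ok (a + m) m k fits m≤R x y)

    findR-ok : ∀ lo n k {c : Fin N} → lo + n ≤ N → n ≤ maxCoins k rState →
               lo ≤ toℕ c → toℕ c < lo + n → run (findR lo n k) c rState ≡ c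
    findR-ok lo n zero    _    n≤1 x y = answer-ok (short-interval-≡ x y n≤1)
    findR-ok lo n (suc k) {c} fits n≤F x y =
      weighPairs-rState {lo + unweighed n ⌊ n /2⌋} {⌊ n /2⌋} (findF lo n k) fits′
        (findF-ok lo n k fits n≤F (inj₁ (x , y , refl))) offScale
      where
      ends : lo + unweighed n ⌊ n /2⌋ + ⌊ n /2⌋ + ⌊ n /2⌋ ≡ lo + n
      ends = unweighed-+-pans lo (⌊n/2⌋+⌊n/2⌋≤n n)

      fits′ : lo + unweighed n ⌊ n /2⌋ + ⌊ n /2⌋ + ⌊ n /2⌋ ≤ N
      fits′ = pairs-fit lo (⌊n/2⌋+⌊n/2⌋≤n n) fits

      offScale : toℕ c < lo + unweighed n ⌊ n /2⌋ ⊎ lo + unweighed n ⌊ n /2⌋ + ⌊ n /2⌋ + ⌊ n /2⌋ ≤ toℕ c →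
                 run (findF lo n k) c rState ≡ c
      offScale (inj₁ c<) = findF-ok lo n k fits n≤F (inj₂ (short-interval-≡ x c< (unweighed-half≤1 n)))
      offScale (inj₂ c≥) = contradiction (subst (_≤ toℕ c) ends c≥) (<⇒≱ y)

    findF-ok : ∀ lo n k {c : Fin N} {s} → lo + n ≤ N → n ≤ maxCoins k fState →
               Located lo n c s → run (findF lo n k) c s ≡ c
    findF-ok lo n zero    _ n≤1 (inj₁ (x , y , _)) = answer-ok (short-interval-≡ x y n≤1)
    findF-ok lo n zero    _ _   (inj₂ c≡lo)        = answer-ok c≡lo
    findF-ok lo n (suc k) {c} {s} fits n≤F = byState s
      where
      m u : ℕ
      m = panSize k n
      u = unweighed n m

      ends : lo + u + m + m ≡ lo + n
      ends = unweighed-+-pans lo (panSize+panSize≤n k n)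

      fits′ : lo + u + m + m ≤ N
      fits′ = pairs-fit lo (panSize+panSize≤n k n) fits

      recurse : ∀ {s} → Located lo u c s → run (findF lo u k) c s ≡ c
      recurse = findF-ok lo u k (≤-trans (+-monoʳ-≤ lo (m∸n≤m n (m + m))) fits)
                                (unweighed-panSize≤maxCoins k n n≤F)

      shrink : Located lo n c fState → toℕ c < lo + u ⊎ lo + u + m + m ≤ toℕ c → Located lo u c fState
      shrink (inj₁ (x , _ , e)) (inj₁ c<) = inj₁ (x , c< , e)
      shrink (inj₁ (_ , y , _)) (inj₂ c≥) = contradiction (subst (_≤ toℕ c) ends c≥) (<⇒≱ y)
      shrink (inj₂ c≡lo)         _        = inj₂ c≡lo

      byState : ∀ s → Located lo n c s → run (findF lo n (suc k)) c s ≡ c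
      byState fState loc =
        weighPairs-fState {lo + u} {m} (findF lo u k) fits′ (m⊓n≤m _ _) (λ pos → recurse (shrink loc pos))
      byState rState (inj₁ (_ , _ , ()))
      byState rState (inj₂ c≡lo) =
        weighPairs-rState {lo + u} {m} (findF lo u k) fits′ (recurse (inj₂ c≡lo)) (λ _ → recurse (inj₂ c≡lo))

  findR-anyState-ok : ∀ lo n k {c : Fin N} s → lo + n ≤ N → n ≤ maxCoins k fState →
                      ⌊ n /2⌋ ≤ maxCoins k rState → lo ≤ toℕ c → toℕ c < lo + n →
                      run (findR lo n (suc k)) c s ≡ c
  findR-anyState-ok lo n k fState fits n≤F h≤R x y =
    weighPairs-fState {lo + unweighed n ⌊ n /2⌋} {⌊ n /2⌋} (findF lo n k)
      (pairs-fit lo (⌊n/2⌋+⌊n/2⌋≤n n) fits) h≤R (λ _ → findF-ok lo n k fits n≤F (inj₁ (x , y , refl)))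
  findR-anyState-ok lo n k rState fits n≤F h≤R x y = findR-ok lo n (suc k) fits n≤F x y

  solvableF : ∀ k → N ≤ maxCoins k fState → Solvable N startF k
  solvableF k N≤F = findF 0 N k , λ c s s≡f → findF-ok 0 N k ≤-refl N≤F (inj₁ (z≤n , toℕ<n c , s≡f))

  solvableAny : ∀ k → N ≤ maxCoins k fState → Solvable N startAny (suc k)
  solvableAny k N≤F = findR 0 N (suc k) , λ c s _ → findR-anyState-ok 0 N k s ≤-refl N≤F h≤R z≤n (toℕ<n c)
    where
    h≤R : ⌊ N /2⌋ ≤ maxCoins k rState
    h≤R = ≤-trans (⌊n/2⌋-mono N≤F) (⌊maxCoins-f/2⌋≤maxCoins-r k)

solvable-mono : ∀ {N k} {S S′ : AltState → Set} → (∀ {s} → S′ s → S s) → Solvable N S k → Solvable N S′ k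
solvable-mono S′⊆S (t , finds) = t , λ c s S′s → finds c s (S′⊆S S′s)

solvable⇒≤maxCoins : ∀ {N k} {S : AltState → Set} {s} → Solvable N S k → S s → N ≤ maxCoins k s
solvable⇒≤maxCoins {s = s} (t , finds) Ss = finds⇒≤maxCoins t s (λ c → finds c s Ss)

isMinWeighings-from-bound : ∀ {P : ℕ → Set} {b : ℕ → ℕ} {N m} →
                            P m → (∀ {k} → P k → N ≤ b k) → (∀ k → k < m → b k < N) → IsMinWeighings P m
isMinWeighings-from-bound Pm bound below = Pm , λ k k<m Pk → <⇒≱ (below k k<m) (bound Pk)

least-reaching : (f : ℕ → ℕ) → (∀ k → f k < f (suc k)) →
                 ∀ n → Σ ℕ (λ k → n ≤ f k × (∀ j → j < k → f j < n))
least-reaching f f-< zero = 0 , z≤n , λ j ()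
least-reaching f f-< (suc n) with least-reaching f f-< n
... | k , n≤fk , below with suc n ≤? f k
...   | yes 1+n≤fk = k , 1+n≤fk , λ j j<k → m<n⇒m<1+n (below j j<k)
...   | no  1+n≰fk = suc k , ≤-trans (s≤s n≤fk) (f-< k) , below′
  where
  below′ : ∀ j → j < suc k → f j < suc n
  below′ j j<1+k with m<1+n⇒m<n∨m≡n j<1+k
  ... | inj₁ j<k  = m<n⇒m<1+n (below j j<k)
  ... | inj₂ refl = ≰⇒> 1+n≰fk

mainTheorem7 : (N : ℕ) → 2 ≤ N →
    Σ ℕ (λ m →
      IsMinWeighings (Solvable N startF) m
      × IsMinWeighings (Solvable N startR) (suc m)
      × IsMinWeighings (Solvable N startAny) (suc m))
mainTheorem7 (suc M) 2≤N with least-reaching (λ k → maxCoins k fState) maxCoins-f-< (suc M)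
... | k , N≤F , F<N =
  k , isMinWeighings-from-bound (solvableF k N≤F) (λ S → solvable⇒≤maxCoins S refl) F<N
    , isMinWeighings-from-bound (solvable-mono (λ _ → tt) (solvableAny k N≤F))
                                (λ S → solvable⇒≤maxCoins S refl) R<N
    , isMinWeighings-from-bound (solvableAny k N≤F) (λ S → solvable⇒≤maxCoins {s = rState} S tt) R<N
  where
  open Strategies M

  R<N : ∀ j → j < suc k → maxCoins j rState < suc M
  R<N zero    _         = 2≤N
  R<N (suc j) (s≤s j<k) = F<N j j<k
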